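{- Let $(A,\sigma)$ be a state BL-algebra and let $s$ be a state on the BL-algebra $\sigma(A)$. Then $s_\sigma:A\to[0,1]$, $s_\sigma(x):=s(\sigma(x))$, is a state on $A$.
   Context: A BL-algebra is an algebra $(A,\wedge,\vee,\odot,\to,0,1)$ of type $(2,2,2,2,0,0)$ such that $(A,\wedge,\vee,0,1)$ is a bounded lattice, $(A,\odot,1)$ is a commutative monoid, and for all $a,b,c\in A$: $c\le a\to b$ iff $a\odot c\le b$; $a\wedge b=a\odot(a\to b)$; $(a\to b)\vee(b\to a)=1$. A state-operator on $A$ is a map $\sigma:A\to A$ such that for all $x,y\in A$: (1) $\sigma(0)=0$; (2) $\sigma(x\to y)=\sigma(x)\to\sigma(x\wedge y)$; (3) $\sigma(x\odot y)=\sigma(x)\odot\sigma(x\to x\odot y)$; (4) $\sigma(\sigma(x)\odot\sigma(y))=\sigma(x)\odot\sigma(y)$; (5) $\sigma(\sigma(x)\to\sigma(y))=\sigma(x)\to\sigma(y)$. The image $\sigma(A)$ is a subalgebra of $A$, regarded as a BL-algebra. A state on a BL-algebra $B$ is a map $s:B\to[0,1]$ with $s(0)=0$, $s(1)=1$ and $s(x)+s(x\to y)=s(y)+s(y\to x)$ for all $x,y\in B$. -}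

module Defs where

open import Level using (Level; _⊔_; suc)
open import Data.Product using (Σ; ∃; _,_; _×_; proj₁; proj₂)
open import Data.Sum using (_⊎_)
open import Relation.Nullary using (¬_)
open import Relation.Binary.PropositionalEquality
  using (_≡_; refl; sym; trans; cong; cong₂; subst)

-- The real numbers, given axiomatically as a (Dedekind-)complete ordered
-- field.  Any two models are isomorphic, so quantifying over all models
-- is the same as working with ℝ.

record RealNumbers (ℓ : Level) : Set (suc ℓ) where
  infixl 6 _+_
  infixl 7 _*_
  infix  4 _≤ℝ_
  field
    ℝ     : Set ℓ
    _+_   : ℝ → ℝ → ℝ
    _*_   : ℝ → ℝ → ℝ
    -_    : ℝ → ℝ
    0ℝ    : ℝ
    1ℝ    : ℝ
    _≤ℝ_  : ℝ → ℝ → Set ℓ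
    +-assoc   : ∀ x y z → (x + y) + z ≡ x + (y + z)
    +-comm    : ∀ x y → x + y ≡ y + x
    +-identʳ  : ∀ x → x + 0ℝ ≡ x
    +-inverse : ∀ x → x + (- x) ≡ 0ℝ
    *-assoc   : ∀ x y z → (x * y) * z ≡ x * (y * z)
    *-comm    : ∀ x y → x * y ≡ y * x
    *-identʳ  : ∀ x → x * 1ℝ ≡ x
    distrib   : ∀ x y z → x * (y + z) ≡ x * y + x * z
    0≢1       : ¬ (0ℝ ≡ 1ℝ)
    *-inverse : ∀ x → ¬ (x ≡ 0ℝ) → Σ ℝ λ y → x * y ≡ 1ℝ
    ≤-refl    : ∀ x → x ≤ℝ x
    ≤-antisym : ∀ {x y} → x ≤ℝ y → y ≤ℝ x → x ≡ y
    ≤-trans   : ∀ {x y z} → x ≤ℝ y → y ≤ℝ z → x ≤ℝ z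
    ≤-total   : ∀ x y → x ≤ℝ y ⊎ y ≤ℝ x
    +-mono-≤  : ∀ {x y} z → x ≤ℝ y → x + z ≤ℝ y + z
    *-nonneg  : ∀ {x y} → 0ℝ ≤ℝ x → 0ℝ ≤ℝ y → 0ℝ ≤ℝ x * y
    sup       : (P : ℝ → Set ℓ) → Σ ℝ P → Σ ℝ (λ b → ∀ x → P x → x ≤ℝ b) →
                Σ ℝ λ s → (∀ x → P x → x ≤ℝ s) ×
                          (∀ b → (∀ x → P x → x ≤ℝ b) → s ≤ℝ b)

record BLAlgebra (a : Level) : Set (suc a) where
  infixr 5 _⇒_
  infixl 7 _⊙_
  infixl 6 _∧_
  infixl 5 _∨_
  infix  4 _≤_
  field
    Carrier : Set a
    _∧_ _∨_ _⊙_ _⇒_ : Carrier → Carrier → Carrier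
    𝟘 𝟙 : Carrier
    ∧-assoc   : ∀ x y z → (x ∧ y) ∧ z ≡ x ∧ (y ∧ z)
    ∨-assoc   : ∀ x y z → (x ∨ y) ∨ z ≡ x ∨ (y ∨ z)
    ∧-comm    : ∀ x y → x ∧ y ≡ y ∧ x
    ∨-comm    : ∀ x y → x ∨ y ≡ y ∨ x
    ∧-absorbs-∨ : ∀ x y → x ∧ (x ∨ y) ≡ x
    ∨-absorbs-∧ : ∀ x y → x ∨ (x ∧ y) ≡ x
    𝟘-bottom  : ∀ x → 𝟘 ∧ x ≡ 𝟘
    𝟙-top     : ∀ x → x ∧ 𝟙 ≡ x
    ⊙-assoc   : ∀ x y z → (x ⊙ y) ⊙ z ≡ x ⊙ (y ⊙ z)
    ⊙-comm    : ∀ x y → x ⊙ y ≡ y ⊙ x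
    ⊙-identʳ  : ∀ x → x ⊙ 𝟙 ≡ x

  _≤_ : Carrier → Carrier → Set a
  x ≤ y = x ∧ y ≡ x

  field
    residuation₁ : ∀ x y z → z ≤ (x ⇒ y) → x ⊙ z ≤ y
    residuation₂ : ∀ x y z → x ⊙ z ≤ y → z ≤ (x ⇒ y)
    divisibility : ∀ x y → x ∧ y ≡ x ⊙ (x ⇒ y)
    prelinearity : ∀ x y → (x ⇒ y) ∨ (y ⇒ x) ≡ 𝟙

module _ {a : Level} (A : BLAlgebra a) where
  open BLAlgebra A

  record IsStateOperator (σ : Carrier → Carrier) : Set a where
    field
      σ-𝟘 : σ 𝟘 ≡ 𝟘
      σ-⇒ : ∀ x y → σ (x ⇒ y) ≡ σ x ⇒ σ (x ∧ y)
      σ-⊙ : ∀ x y → σ (x ⊙ y) ≡ σ x ⊙ σ (x ⇒ x ⊙ y)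
      σ-σ⊙ : ∀ x y → σ (σ x ⊙ σ y) ≡ σ x ⊙ σ y
      σ-σ⇒ : ∀ x y → σ (σ x ⇒ σ y) ≡ σ x ⇒ σ y

record StateBLAlgebra (a : Level) : Set (suc a) where
  field
    algebra         : BLAlgebra a
    σ               : BLAlgebra.Carrier algebra → BLAlgebra.Carrier algebra
    isStateOperator : IsStateOperator algebra σ

module _ {a ℓ : Level} (R : RealNumbers ℓ) (B : BLAlgebra a) where
  open RealNumbers R
  open BLAlgebra B

  record IsState (s : Carrier → ℝ) : Set (a ⊔ ℓ) where
    field
      in-[0,1] : ∀ x → (0ℝ ≤ℝ s x) × (s x ≤ℝ 1ℝ)
      s-𝟘      : s 𝟘 ≡ 0ℝ
      s-𝟙      : s 𝟙 ≡ 1ℝ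
      s-⇒      : ∀ x y → s x + s (x ⇒ y) ≡ s y + s (y ⇒ x)

module ImageSubalgebra {a : Level} (SA : StateBLAlgebra a) where
  open StateBLAlgebra SA
  open BLAlgebra algebra
  open IsStateOperator isStateOperator

  InImage : Carrier → Set a
  InImage u = Σ Carrier λ x → σ x ≡ u

  Img : Set a
  Img = Σ Carrier InImage

  private
    ∧-idem : ∀ x → x ∧ x ≡ x
    ∧-idem x = trans (cong (x ∧_) (sym (∨-absorbs-∧ x x))) (∧-absorbs-∨ x (x ∧ x))

    ⇒-self : ∀ x → x ⇒ x ≡ 𝟙
    ⇒-self x = trans (sym (𝟙-top (x ⇒ x)))
                 (trans (∧-comm (x ⇒ x) 𝟙) step)
      where
      step : 𝟙 ∧ (x ⇒ x) ≡ 𝟙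
      step = residuation₂ x x 𝟙 (trans (cong (_∧ x) (⊙-identʳ x)) (trans (∧-idem x) (sym (⊙-identʳ x))))

    closed-⇒ : ∀ u v → InImage u → InImage v → InImage (u ⇒ v)
    closed-⇒ u v (x , refl) (y , refl) = (σ x ⇒ σ y) , σ-σ⇒ x y

    closed-⊙ : ∀ u v → InImage u → InImage v → InImage (u ⊙ v)
    closed-⊙ u v (x , refl) (y , refl) = (σ x ⊙ σ y) , σ-σ⊙ x y

  𝟘ᵢ : Img
  𝟘ᵢ = 𝟘 , 𝟘 , σ-𝟘

  𝟙ᵢ : Img
  𝟙ᵢ = 𝟙 , (𝟘 ⇒ 𝟘) ,
       trans (σ-⇒ 𝟘 𝟘) (trans (cong (λ z → σ 𝟘 ⇒ σ z) (∧-idem 𝟘)) (⇒-self (σ 𝟘)))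

  _⇒ᵢ_ : Img → Img → Img
  (u , p) ⇒ᵢ (v , q) = (u ⇒ v) , closed-⇒ u v p q

  _⊙ᵢ_ : Img → Img → Img
  (u , p) ⊙ᵢ (v , q) = (u ⊙ v) , closed-⊙ u v p q

  -- a state on the BL-algebra σ(A): a state whose domain is σ(A), the
  -- operations being those of the subalgebra σ(A) (only 𝟘, 𝟙 and ⇒ enter
  -- the definition of a state).
  record IsStateOnImage {ℓ : Level} (R : RealNumbers ℓ) (s : Img → RealNumbers.ℝ R)
         : Set (a ⊔ ℓ) where
    open RealNumbers R
    field
      in-[0,1] : ∀ u → (0ℝ ≤ℝ s u) × (s u ≤ℝ 1ℝ)
      s-𝟘      : s 𝟘ᵢ ≡ 0ℝ
      s-𝟙      : s 𝟙ᵢ ≡ 1ℝ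
      s-⇒      : ∀ u v → s u + s (u ⇒ᵢ v) ≡ s v + s (v ⇒ᵢ u)

  sσ : ∀ {ℓ} (R : RealNumbers ℓ) → (Img → RealNumbers.ℝ R) → Carrier → RealNumbers.ℝ R
  sσ R s x = s (σ x , x , refl)

-- Writing ⟨u⟩ for an element u of σ(A), the state axiom of s yields
-- s⟨σx⟩ + s⟨σ(x → y)⟩ = s⟨σ(x ∧ y)⟩ + 1: indeed σ(x → y) = σx → σ(x ∧ y),
-- and σ(x ∧ y) → σx = 1 because σ is monotone.  The right-hand side is
-- symmetric in x and y, which is the state axiom for s_σ.  Elements of σ(A)
-- carry a preimage as witness, so one first checks that s ignores it.
module Submission where

open import Level using (Level)
open import Defs
open import Data.Product using (_,_; proj₁)
open import Relation.Binary.PropositionalEquality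
  using (_≡_; refl; sym; trans; cong; cong₂; subst; module ≡-Reasoning)
open import Axiom.UniquenessOfIdentityProofs.WithK using (uip)

module RealProperties {ℓ : Level} (R : RealNumbers ℓ) where
  open RealNumbers R
  open ≡-Reasoning

  +-identityˡ : ∀ x → 0ℝ + x ≡ x
  +-identityˡ x = trans (+-comm 0ℝ x) (+-identʳ x)

  +-cancelʳ : ∀ {x y} z → x + z ≡ y + z → x ≡ y
  +-cancelʳ {x} {y} z eq = begin
    x                ≡⟨ sym (+-identʳ x) ⟩
    x + 0ℝ           ≡⟨ cong (x +_) (sym (+-inverse z)) ⟩
    x + (z + - z)    ≡⟨ sym (+-assoc x z (- z)) ⟩
    (x + z) + - z    ≡⟨ cong (_+ - z) eq ⟩
    (y + z) + - z    ≡⟨ +-assoc y z (- z) ⟩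
    y + (z + - z)    ≡⟨ cong (y +_) (+-inverse z) ⟩
    y + 0ℝ           ≡⟨ +-identʳ y ⟩
    y                ∎

module BLAlgebraProperties {a : Level} (A : BLAlgebra a) where
  open BLAlgebra A

  ∧-idem : ∀ x → x ∧ x ≡ x
  ∧-idem x = trans (cong (x ∧_) (sym (∨-absorbs-∧ x x))) (∧-absorbs-∨ x (x ∧ x))

  x∧y≤x : ∀ x y → x ∧ y ≤ x
  x∧y≤x x y = trans (∧-comm (x ∧ y) x)
                (trans (sym (∧-assoc x x y)) (cong (_∧ y) (∧-idem x)))

  ≤⇒⇒≡𝟙 : ∀ {x y} → x ≤ y → x ⇒ y ≡ 𝟙
  ≤⇒⇒≡𝟙 {x} {y} x≤y = trans (sym (𝟙-top (x ⇒ y))) (trans (∧-comm (x ⇒ y) 𝟙) 𝟙≤x⇒y)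
    where
    x⊙𝟙≤y : x ⊙ 𝟙 ≤ y
    x⊙𝟙≤y = trans (cong (_∧ y) (⊙-identʳ x)) (trans x≤y (sym (⊙-identʳ x)))

    𝟙≤x⇒y : 𝟙 ≤ x ⇒ y
    𝟙≤x⇒y = residuation₂ x y 𝟙 x⊙𝟙≤y

  ⇒-refl : ∀ x → x ⇒ x ≡ 𝟙
  ⇒-refl x = ≤⇒⇒≡𝟙 (∧-idem x)

  x⊙y≤x : ∀ x y → x ⊙ y ≤ x
  x⊙y≤x x y = residuation₁ x x y (trans (cong (y ∧_) (⇒-refl x)) (𝟙-top y))

module StateOperatorProperties {a : Level} (A : BLAlgebra a) {σ : BLAlgebra.Carrier A → BLAlgebra.Carrier A}
    (isStateOperator : IsStateOperator A σ) where
  open BLAlgebra A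
  open IsStateOperator isStateOperator
  open BLAlgebraProperties A
  open ≡-Reasoning

  σ-𝟙 : σ 𝟙 ≡ 𝟙
  σ-𝟙 = begin
    σ 𝟙                 ≡⟨ cong σ (sym (⇒-refl 𝟙)) ⟩
    σ (𝟙 ⇒ 𝟙)           ≡⟨ σ-⇒ 𝟙 𝟙 ⟩
    σ 𝟙 ⇒ σ (𝟙 ∧ 𝟙)     ≡⟨ cong (λ z → σ 𝟙 ⇒ σ z) (∧-idem 𝟙) ⟩
    σ 𝟙 ⇒ σ 𝟙           ≡⟨ ⇒-refl (σ 𝟙) ⟩
    𝟙                   ∎

  -- x ≤ y means x = y ⊙ (y → x), and σ(y ⊙ z) = σy ⊙ σ(…) ≤ σy.
  σ-mono : ∀ {x y} → x ≤ y → σ x ≤ σ y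
  σ-mono {x} {y} x≤y = subst (_≤ σ y) (sym σx≡) (x⊙y≤x (σ y) _)
    where
    σx≡ : σ x ≡ σ y ⊙ σ (y ⇒ y ⊙ (y ⇒ x))
    σx≡ = trans (cong σ (trans (sym x≤y) (trans (∧-comm x y) (divisibility y x))))
                (σ-⊙ y (y ⇒ x))

module ImageProperties {a : Level} (SA : StateBLAlgebra a) where
  open StateBLAlgebra SA
  open BLAlgebra algebra
  open IsStateOperator isStateOperator
  open ImageSubalgebra SA

  fixed-≡ : ∀ {w w'} (p : σ w ≡ w) (p' : σ w' ≡ w') → w ≡ w' →
            _≡_ {A = Img} (w , w , p) (w' , w' , p')
  fixed-≡ p p' refl = cong (λ q → (_ , _ , q)) (uip p p')

  ⇒ᵢ-cong : ∀ {u u' v v' : Img} → proj₁ u ≡ proj₁ u' → proj₁ v ≡ proj₁ v' →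
            u ⇒ᵢ v ≡ u' ⇒ᵢ v'
  ⇒ᵢ-cong {_ , x , refl} {_ , x' , refl} {_ , y , refl} {_ , y' , refl} eu ev =
    fixed-≡ (σ-σ⇒ x y) (σ-σ⇒ x' y') (cong₂ _⇒_ eu ev)

module StateOnImageProperties {a ℓ : Level} (R : RealNumbers ℓ) (SA : StateBLAlgebra a)
    (s : ImageSubalgebra.Img SA → RealNumbers.ℝ R)
    (isState : ImageSubalgebra.IsStateOnImage SA R s) where
  open RealNumbers R
  open RealProperties R
  open StateBLAlgebra SA
  open BLAlgebra algebra
  open BLAlgebraProperties algebra
  open IsStateOperator isStateOperator
  open StateOperatorProperties algebra isStateOperator
  open ImageSubalgebra SA
  open ImageProperties SA
  open IsStateOnImage isState
  open ≡-Reasoning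

  -- Both sides satisfy  s u + s (u ⇒ᵢ 𝟘ᵢ) = s (𝟘ᵢ ⇒ᵢ u), and ⇒ᵢ ignores witnesses.
  s-irrelevant : ∀ {u v : Img} → proj₁ u ≡ proj₁ v → s u ≡ s v
  s-irrelevant {u} {v} eq =
    +-cancelʳ (s (u ⇒ᵢ 𝟘ᵢ)) (begin
      s u + s (u ⇒ᵢ 𝟘ᵢ)    ≡⟨ s-⇒ u 𝟘ᵢ ⟩
      s 𝟘ᵢ + s (𝟘ᵢ ⇒ᵢ u)   ≡⟨ cong (s 𝟘ᵢ +_) (cong s (⇒ᵢ-cong refl eq)) ⟩
      s 𝟘ᵢ + s (𝟘ᵢ ⇒ᵢ v)   ≡⟨ sym (s-⇒ v 𝟘ᵢ) ⟩
      s v + s (v ⇒ᵢ 𝟘ᵢ)    ≡⟨ cong (s v +_) (cong s (⇒ᵢ-cong (sym eq) refl)) ⟩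
      s v + s (u ⇒ᵢ 𝟘ᵢ)    ∎)

  ⟨σ_⟩ : Carrier → Img
  ⟨σ x ⟩ = σ x , x , refl

  sσ-⇒ : ∀ x y → s ⟨σ x ⟩ + s ⟨σ x ⇒ y ⟩ ≡ s ⟨σ x ∧ y ⟩ + 1ℝ
  sσ-⇒ x y = begin
    s ⟨σ x ⟩ + s ⟨σ x ⇒ y ⟩              ≡⟨ cong (s ⟨σ x ⟩ +_) (s-irrelevant (σ-⇒ x y)) ⟩
    s ⟨σ x ⟩ + s (⟨σ x ⟩ ⇒ᵢ ⟨σ x ∧ y ⟩)    ≡⟨ s-⇒ ⟨σ x ⟩ ⟨σ x ∧ y ⟩ ⟩
    s ⟨σ x ∧ y ⟩ + s (⟨σ x ∧ y ⟩ ⇒ᵢ ⟨σ x ⟩) ≡⟨ cong (s ⟨σ x ∧ y ⟩ +_) s-σ[x∧y]⇒σx ⟩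
    s ⟨σ x ∧ y ⟩ + 1ℝ                    ∎
    where
    s-σ[x∧y]⇒σx : s (⟨σ x ∧ y ⟩ ⇒ᵢ ⟨σ x ⟩) ≡ 1ℝ
    s-σ[x∧y]⇒σx = trans (s-irrelevant (≤⇒⇒≡𝟙 (σ-mono (x∧y≤x x y)))) s-𝟙

proposition6p1 : {a ℓ : Level} (R : RealNumbers ℓ) (SA : StateBLAlgebra a)
    (s : ImageSubalgebra.Img SA → RealNumbers.ℝ R) →
    ImageSubalgebra.IsStateOnImage SA R s →
    IsState R (StateBLAlgebra.algebra SA) (ImageSubalgebra.sσ SA R s)
proposition6p1 R SA s isState = record
  { in-[0,1] = λ x → in-[0,1] ⟨σ x ⟩
  ; s-𝟘      = trans (s-irrelevant σ-𝟘) s-𝟘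
  ; s-𝟙      = trans (s-irrelevant σ-𝟙) s-𝟙
  ; s-⇒      = λ x y → trans (sσ-⇒ x y)
                 (trans (cong (_+ 1ℝ) (s-irrelevant (cong σ (∧-comm x y))))
                        (sym (sσ-⇒ y x)))
  }
  where
  open RealNumbers R
  open StateBLAlgebra SA
  open BLAlgebra algebra using (∧-comm)
  open IsStateOperator isStateOperator using (σ-𝟘)
  open StateOperatorProperties algebra isStateOperator using (σ-𝟙)
  open ImageSubalgebra.IsStateOnImage isState
  open StateOnImageProperties R SA s isState
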